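{- In the propositional logic $L_{\rm LEA}$ the following hold for all formulas $\varphi,\psi,\chi$: (a) $\varphi\rightarrow\psi,\psi\rightarrow\chi\vdash\varphi\rightarrow\chi$; (b) $\vdash\varphi\rightarrow1$; (c) $\vdash\varphi\rightarrow\varphi$; (d) $\vdash\psi\rightarrow(\psi\vee\varphi)$; (e) $\vdash\neg\neg\varphi\leftrightarrow\varphi$; (f) $\varphi\rightarrow\psi\vdash(\neg\varphi\rightarrow\neg\psi)\leftrightarrow(\psi\rightarrow\varphi)$; (g) $\vdash\psi\rightarrow(\varphi\vee\psi)$ and $\vdash(\varphi\vee\psi)\leftrightarrow(\psi\vee\varphi)$; (h) $\varphi\rightarrow\psi,\chi\rightarrow\psi\vdash(\varphi\vee\chi)\rightarrow\psi$; (i) $\vdash(\varphi\rightarrow\psi)\leftrightarrow((\varphi\vee\psi)\rightarrow\psi)$; (j) $\vdash(\neg\varphi\rightarrow\neg(\psi\vee\varphi))\leftrightarrow(\psi\rightarrow\varphi)$.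
   Context: Formulas are built from propositional variables using a binary connective $\rightarrow$ and a constant $0$. Abbreviations: $\neg\varphi:=\varphi\rightarrow0$, $1:=\neg0=0\rightarrow0$, $\psi\vee\varphi:=(\psi\rightarrow\varphi)\rightarrow\varphi$. The logic $L_{\rm LEA}$ is the consequence relation $\vdash$ of the deductive system with axiom schemes (A1) $\varphi\rightarrow(\psi\rightarrow\varphi)$; (A2) $((\varphi\rightarrow\psi)\rightarrow\psi)\rightarrow((\psi\rightarrow\varphi)\rightarrow\varphi)$; (A3) $0\rightarrow\varphi$; and inference rules (MP) $\varphi,\varphi\rightarrow\psi\vdash\psi$; (Sf) $\varphi\rightarrow\psi\vdash(\psi\rightarrow\chi)\rightarrow(\varphi\rightarrow\chi)$; (WPf) $\varphi\rightarrow\psi,\psi\rightarrow\varphi\vdash(\chi\rightarrow\varphi)\rightarrow(\chi\rightarrow\psi)$; (R1) $\varphi\rightarrow\psi\vdash(\neg\varphi\rightarrow\neg\psi)\rightarrow(\psi\rightarrow\varphi)$; (R2) $\varphi\rightarrow\neg\psi,(\neg\varphi\rightarrow\psi)\rightarrow\neg\chi\vdash(\neg(\neg\varphi\rightarrow\psi)\rightarrow\chi)\rightarrow(\neg\varphi\rightarrow(\neg\psi\rightarrow\chi))$. That is, $\Gamma\vdash\varphi$ iff $\varphi$ is derivable from $\Gamma$ and instances of the axioms by the rules. $\Gamma\vdash\alpha\leftrightarrow\beta$ abbreviates: $\Gamma\vdash\alpha\rightarrow\beta$ and $\Gamma\vdash\beta\rightarrow\alpha$. -}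

module Defs where

open import Data.Nat using (ℕ)
open import Data.Product using (_×_)
open import Level using (Level; suc; _⊔_)

infixr 5 _⇒_
infix 7 ¬′_
infix 6 _∨′_
infix 2 _⊢_
infix 2 _⊢_⇔_

data Formula : Set where
  var : ℕ → Formula
  𝟘   : Formula
  _⇒_ : Formula → Formula → Formula

¬′_ : Formula → Formula
¬′ φ = φ ⇒ 𝟘

𝟙 : Formula
𝟙 = 𝟘 ⇒ 𝟘

_∨′_ : Formula → Formula → Formula
ψ ∨′ φ = (ψ ⇒ φ) ⇒ φ

Theory : Set₁
Theory = Formula → Set

data _⊢_ (Γ : Theory) : Formula → Set where
  hyp : ∀ {φ} → Γ φ → Γ ⊢ φ
  A1  : ∀ φ ψ → Γ ⊢ (φ ⇒ (ψ ⇒ φ))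
  A2  : ∀ φ ψ → Γ ⊢ (((φ ⇒ ψ) ⇒ ψ) ⇒ ((ψ ⇒ φ) ⇒ φ))
  A3  : ∀ φ → Γ ⊢ (𝟘 ⇒ φ)
  MP  : ∀ {φ ψ} → Γ ⊢ φ → Γ ⊢ (φ ⇒ ψ) → Γ ⊢ ψ
  Sf  : ∀ {φ ψ} χ → Γ ⊢ (φ ⇒ ψ) → Γ ⊢ ((ψ ⇒ χ) ⇒ (φ ⇒ χ))
  WPf : ∀ {φ ψ} χ → Γ ⊢ (φ ⇒ ψ) → Γ ⊢ (ψ ⇒ φ) → Γ ⊢ ((χ ⇒ φ) ⇒ (χ ⇒ ψ))
  R1  : ∀ {φ ψ} → Γ ⊢ (φ ⇒ ψ) → Γ ⊢ ((¬′ φ ⇒ ¬′ ψ) ⇒ (ψ ⇒ φ))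
  R2  : ∀ {φ ψ χ} → Γ ⊢ (φ ⇒ ¬′ ψ) → Γ ⊢ ((¬′ φ ⇒ ψ) ⇒ ¬′ χ)
        → Γ ⊢ ((¬′ (¬′ φ ⇒ ψ) ⇒ χ) ⇒ (¬′ φ ⇒ (¬′ ψ ⇒ χ)))

∅ : Theory
∅ _ = Data.Empty.⊥
  where import Data.Empty

data ⟦_⟧ (φ : Formula) : Theory where
  here : ⟦ φ ⟧ φ

data ⟦_,_⟧ (φ ψ : Formula) : Theory where
  fst : ⟦ φ , ψ ⟧ φ
  snd : ⟦ φ , ψ ⟧ ψ

_⊢_⇔_ : Theory → Formula → Formula → Set
Γ ⊢ α ⇔ β = (Γ ⊢ (α ⇒ β)) × (Γ ⊢ (β ⇒ α))

-- Axiom A2 says that ∨ is commutative, and together with A1 it yields the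
-- injections ψ → ψ ∨ φ and ψ → φ ∨ ψ; read with φ ∨ ψ = (φ → ψ) → ψ, the
-- first injection is internal modus ponens φ → ((φ → ψ) → ψ). Everything else
-- is obtained by chaining these with the rules Sf, WPf and R1: identity comes
-- from (1 → φ) → φ, which is A2 at 1 applied to the theorem (φ → 1) → 1;
-- double negation elimination is A2 at 0 with 0 → φ discharged by A3; and
-- ∨-elimination is monotonicity of ∨ (Sf twice) followed by commutativity.
module Submission where

open import Data.Product using (_×_) renaming (_,_ to _&_)
open import Defs

module _ {Γ : Theory} where

  ⇔-sym : ∀ {α β} → Γ ⊢ α ⇔ β → Γ ⊢ β ⇔ α
  ⇔-sym (p & q) = q & p

  ⇒-trans : ∀ {φ ψ χ} → Γ ⊢ (φ ⇒ ψ) → Γ ⊢ (ψ ⇒ χ) → Γ ⊢ (φ ⇒ χ)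
  ⇒-trans p q = MP q (Sf _ p)

  ⇔-trans : ∀ {α β γ} → Γ ⊢ α ⇔ β → Γ ⊢ β ⇔ γ → Γ ⊢ α ⇔ γ
  ⇔-trans (p & p′) (q & q′) = ⇒-trans p q & ⇒-trans q′ p′

  ⇒-weaken : ∀ {φ} ψ → Γ ⊢ φ → Γ ⊢ (ψ ⇒ φ)
  ⇒-weaken ψ p = MP p (A1 _ ψ)

  𝟙-intro : Γ ⊢ 𝟙
  𝟙-intro = A3 𝟘

  ∨-comm : ∀ φ ψ → Γ ⊢ ((φ ∨′ ψ) ⇒ (ψ ∨′ φ))
  ∨-comm = A2

  ∨-inj₁ : ∀ ψ φ → Γ ⊢ (ψ ⇒ (ψ ∨′ φ))
  ∨-inj₁ ψ φ = ⇒-trans (A1 ψ (φ ⇒ ψ)) (∨-comm φ ψ)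

  ∨-inj₂ : ∀ φ ψ → Γ ⊢ (ψ ⇒ (φ ∨′ ψ))
  ∨-inj₂ φ ψ = A1 ψ (φ ⇒ ψ)

  ⇒-apply : ∀ {φ} ψ → Γ ⊢ φ → Γ ⊢ ((φ ⇒ ψ) ⇒ ψ)
  ⇒-apply ψ p = MP p (∨-inj₁ _ ψ)

  ⇒-discharge : ∀ {φ ψ χ} → Γ ⊢ (φ ⇒ (ψ ⇒ χ)) → Γ ⊢ ψ → Γ ⊢ (φ ⇒ χ)
  ⇒-discharge p q = ⇒-trans p (⇒-apply _ q)

  𝟙⇒-elim : ∀ φ → Γ ⊢ ((𝟙 ⇒ φ) ⇒ φ)
  𝟙⇒-elim φ = MP (⇒-weaken (φ ⇒ 𝟙) 𝟙-intro) (A2 φ 𝟙)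

  ⇒-refl : ∀ φ → Γ ⊢ (φ ⇒ φ)
  ⇒-refl φ = MP (𝟙⇒-elim φ) (Sf φ (A1 φ 𝟙))

  ¬¬-elim : ∀ φ → Γ ⊢ (¬′ ¬′ φ ⇒ φ)
  ¬¬-elim φ = ⇒-discharge (A2 φ 𝟘) (A3 φ)

  ¬¬-intro : ∀ φ → Γ ⊢ (φ ⇒ ¬′ ¬′ φ)
  ¬¬-intro φ = ∨-inj₁ φ 𝟘

  ¬¬-⇔ : ∀ φ → Γ ⊢ ¬′ ¬′ φ ⇔ φ
  ¬¬-⇔ φ = ¬¬-elim φ & ¬¬-intro φ

  -- Contrapose φ → ψ twice, then replace ¬¬φ, ¬¬ψ by φ, ψ using WPf and Sf.
  R1-converse : ∀ {φ ψ} → Γ ⊢ (φ ⇒ ψ) → Γ ⊢ ((ψ ⇒ φ) ⇒ (¬′ φ ⇒ ¬′ ψ))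
  R1-converse {φ} {ψ} p =
    ⇒-trans (WPf ψ (¬¬-intro φ) (¬¬-elim φ))
      (⇒-trans (Sf (¬′ ¬′ φ) (¬¬-elim ψ)) (R1 (Sf 𝟘 p)))

  R1-⇔ : ∀ {φ ψ} → Γ ⊢ (φ ⇒ ψ) → Γ ⊢ (¬′ φ ⇒ ¬′ ψ) ⇔ (ψ ⇒ φ)
  R1-⇔ p = R1 p & R1-converse p

  ∨-monoˡ : ∀ {φ ψ} χ → Γ ⊢ (φ ⇒ ψ) → Γ ⊢ ((φ ∨′ χ) ⇒ (ψ ∨′ χ))
  ∨-monoˡ χ p = Sf χ (Sf χ p)

  ∨-elim : ∀ {φ ψ χ} → Γ ⊢ (φ ⇒ ψ) → Γ ⊢ (χ ⇒ ψ) → Γ ⊢ ((φ ∨′ χ) ⇒ ψ)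
  ∨-elim {ψ = ψ} {χ} p q =
    ⇒-trans (∨-monoˡ χ p) (⇒-trans (∨-comm ψ χ) (⇒-apply ψ q))

  ⇒-⇔-∨⇒ : ∀ φ ψ → Γ ⊢ (φ ⇒ ψ) ⇔ ((φ ∨′ ψ) ⇒ ψ)
  ⇒-⇔-∨⇒ φ ψ = ∨-inj₁ (φ ⇒ ψ) ψ & Sf ψ (∨-inj₁ φ ψ)

theorem3p1 : (φ ψ χ : Formula)
    → (⟦ φ ⇒ ψ , ψ ⇒ χ ⟧ ⊢ (φ ⇒ χ))
    × (∅ ⊢ (φ ⇒ 𝟙))
    × (∅ ⊢ (φ ⇒ φ))
    × (∅ ⊢ (ψ ⇒ (ψ ∨′ φ)))
    × (∅ ⊢ (¬′ (¬′ φ)) ⇔ φ)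
    × (⟦ φ ⇒ ψ ⟧ ⊢ (¬′ φ ⇒ ¬′ ψ) ⇔ (ψ ⇒ φ))
    × ((∅ ⊢ (ψ ⇒ (φ ∨′ ψ))) × (∅ ⊢ (φ ∨′ ψ) ⇔ (ψ ∨′ φ)))
    × (⟦ φ ⇒ ψ , χ ⇒ ψ ⟧ ⊢ ((φ ∨′ χ) ⇒ ψ))
    × (∅ ⊢ (φ ⇒ ψ) ⇔ ((φ ∨′ ψ) ⇒ ψ))
    × (∅ ⊢ (¬′ φ ⇒ ¬′ (ψ ∨′ φ)) ⇔ (ψ ⇒ φ))
theorem3p1 φ ψ χ =
    ⇒-trans (hyp fst) (hyp snd)
  & ⇒-weaken φ 𝟙-intro
  & ⇒-refl φ
  & ∨-inj₁ ψ φ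
  & ¬¬-⇔ φ
  & R1-⇔ (hyp here)
  & (∨-inj₂ φ ψ & (∨-comm φ ψ & ∨-comm ψ φ))
  & ∨-elim (hyp fst) (hyp snd)
  & ⇒-⇔-∨⇒ φ ψ
  & ⇔-trans (R1-⇔ (∨-inj₂ ψ φ)) (⇔-sym (⇒-⇔-∨⇒ ψ φ))
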